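{- Let $G_1,\ldots,G_n$ be nondeterministic automata, where $G_i$ has set of secret states $Q_i^S$, and consider the composed system $G_1\|\cdots\|G_n$ with interaction $\|_\land$, i.e. with set of secret states $Q^S=Q_1^S\times\cdots\times Q_n^S$. Let $\sim$ be an opaque observation equivalence on $G_1$ and let $\tilde G_1$ be the quotient automaton of $G_1$ modulo $\sim$. Then $G_1\|\cdots\|G_n$ is current-state opaque if and only if $\tilde G_1\|G_2\|\cdots\|G_n$ is current-state opaque (with secret states defined in the same $\|_\land$ manner).
   Context: An automaton is $G=\langle\Sigma_\tau,Q,\to,Q^\circ\rangle$ with finite set $\Sigma$ of observable events, a special unobservable event $\tau\notin\Sigma$, $\Sigma_\tau=\Sigma\cup\{\tau\}$, finite state set $Q$, transition relation $\to\subseteq Q\times\Sigma_\tau\times Q$ and initial states $Q^\circ\subseteq Q$; it also carries a set of secret states $Q^S\subseteq Q$, with $Q^{NS}=Q\setminus Q^S$. Transitions extend to strings; for $s\in\Sigma^*$, $p\stackrel{s}{\Rightarrow}q$ means there is $t\in\Sigma_\tau^*$ such that deleting all $\tau$'s from $t$ gives $s$ and $p\stackrel{t}{\to}q$; $p\stackrel{s}{\Rightarrow}Y$ means $p\stackrel{s}{\Rightarrow}q$ for some $q\in Y$; $L(G,q)=\{s\in\Sigma^*: q\stackrel{s}{\Rightarrow}q' \text{ for some } q'\}$. Synchronous composition of $G_1$ and $G_2$: event set $\Sigma_1\cup\Sigma_2$ (plus $\tau$), states $Q_1\times Q_2$, initial states $Q_1^\circ\times Q_2^\circ$, transitions $(x_1,x_2)\stackrel{\sigma}{\to}(y_1,y_2)$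 if $\sigma\in\Sigma_1\cap\Sigma_2$ and both components make a $\sigma$-transition; $(x_1,x_2)\stackrel{\sigma}{\to}(y_1,x_2)$ if $\sigma\in(\Sigma_1\setminus\Sigma_2)\cup\{\tau\}$ and $x_1\stackrel{\sigma}{\to}_1y_1$; symmetrically for the second component. Iterated compositions are formed in the same way. Current-state opacity: $G$ is current-state opaque w.r.t. $Q^S$ iff for every $q^\circ\in Q^\circ$ and every $s\in L(G,q^\circ)$ with $q^\circ\stackrel{s}{\Rightarrow}Q^S$, there exists $q'^\circ\in Q^\circ$ with $q'^\circ\stackrel{s}{\Rightarrow}Q^{NS}$. Opaque observation equivalence: an equivalence relation $\sim$ on $Q$ such that whenever $x_1\sim x_2$: (i) if $x_1\stackrel{s}{\Rightarrow}y_1$ for some $s\in\Sigma^*$, then there is $y_2$ with $x_2\stackrel{s}{\Rightarrow}y_2$ and $y_1\sim y_2$; (ii) $x_1\in Q^S$ iff $x_2\in Q^S$. Quotient automaton modulo $\sim$: states are the classes $[x]$, $([x],\sigma,[y])$ is a transition iff $x'\stackrel{\sigma}{\to}y'$ for some $x'\in[x]$, $y'\in[y]$, initial states $\{[x^\circ]:x^\circ\in Q^\circ\}$; a class $[x]$ is secret iff $x\in Q^S$. -}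

module Defs where

open import Data.Nat using (ℕ) renaming (suc to sucℕ)
open import Data.Fin using (Fin; zero; suc)
open import Data.List using (List; []; _∷_)
open import Data.List.Membership.Propositional using (_∈_)
open import Data.Product using (Σ; ∃; _×_; _,_)
open import Data.Sum using (_⊎_)
open import Relation.Nullary using (¬_)
open import Relation.Binary.PropositionalEquality using (_≡_)
open import Relation.Binary.Structures using (IsEquivalence)
open import Function.Bundles using (_⇔_)

data Evt (E : Set) : Set where
  τ  : Evt E
  ev : E → Evt E

record Automaton (E : Set) : Set₁ where
  field
    alphabet : List E
    size     : ℕ
    trans    : Fin size → Evt E → Fin size → Set
    trans-ok : ∀ {x σ y} → trans x (ev σ) y → σ ∈ alphabet
    initial  : Fin size → Set
    secret   : Fin size → Set

  State : Set
  State = Fin size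

record LTS (E : Set) : Set₁ where
  field
    State   : Set
    trans   : State → Evt E → State → Set
    initial : State → Set
    secret  : State → Set

toLTS : ∀ {E} → Automaton E → LTS E
toLTS G = record
  { State = Automaton.State G ; trans = Automaton.trans G
  ; initial = Automaton.initial G ; secret = Automaton.secret G }

module _ {E : Set} (G : LTS E) where
  open LTS G

  data _⇒[_]_ : State → List E → State → Set where
    done : ∀ {p} → p ⇒[ [] ] p
    stepτ : ∀ {p p' s q} → trans p τ p' → p' ⇒[ s ] q → p ⇒[ s ] q
    stepσ : ∀ {p p' σ s q} → trans p (ev σ) p' → p' ⇒[ s ] q → p ⇒[ σ ∷ s ] q

  CurrentStateOpaque : Set
  CurrentStateOpaque =
    ∀ (q₀ : State) (s : List E) → initial q₀ →
    (∃ λ q → q₀ ⇒[ s ] q × secret q) →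
    ∃ λ q₀' → initial q₀' × (∃ λ q → q₀' ⇒[ s ] q × ¬ secret q)

_⊢_⇒[_]_ : ∀ {E} (G : Automaton E) → Automaton.State G → List E → Automaton.State G → Set
G ⊢ p ⇒[ s ] q = _⇒[_]_ (toLTS G) p s q

record IsOpaqueObsEquiv {E : Set} (G : Automaton E)
         (_∼_ : Automaton.State G → Automaton.State G → Set) : Set where
  open Automaton G
  field
    isEquivalence : IsEquivalence _∼_
    simulation : ∀ {x₁ x₂ y₁} {s : List E} → x₁ ∼ x₂ → G ⊢ x₁ ⇒[ s ] y₁ →
                 ∃ λ y₂ → G ⊢ x₂ ⇒[ s ] y₂ × y₁ ∼ y₂
    secret-resp : ∀ {x₁ x₂} → x₁ ∼ x₂ → secret x₁ ⇔ secret x₂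

-- Since Agda (without cubical) has no
-- quotient types, the class [x] is represented by any of its members x;
-- two representatives denote the same class iff they are ∼-related.
--   [x] -σ-> [y]  iff  x' -σ-> y' for some x' ∈ [x], y' ∈ [y]
--   [x] initial   iff  [x] = [x°] for some initial x°
--   [x] secret    iff  x secret
quotient : ∀ {E} (G : Automaton E) (_∼_ : Automaton.State G → Automaton.State G → Set) →
           Automaton E
quotient {E} G _∼_ = record
  { alphabet = alphabet
  ; size = size
  ; trans = qtrans
  ; trans-ok = ok
  ; initial = λ x → ∃ λ x₀ → initial x₀ × x ∼ x₀
  ; secret = secret }
  where
  open Automaton G
  qtrans : State → Evt E → State → Set
  qtrans x σ y = ∃ λ x' → ∃ λ y' → x ∼ x' × y ∼ y' × trans x' σ y'
  ok : ∀ {x σ y} → qtrans x (ev σ) y → σ ∈ alphabet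
  ok (x' , y' , _ , _ , t) = trans-ok t

-- Synchronous composition G₀ ‖ G₁ ‖ ⋯ ‖ G_{k-1} (n-ary form of the iterated
-- binary composition), with interaction ‖_∧: a global state is secret iff
-- every component state is secret.
compose : ∀ {E} {k : ℕ} → (Fin k → Automaton E) → LTS E
compose {E} {k} G = record
  { State = (i : Fin k) → Automaton.State (G i)
  ; trans = ctrans
  ; initial = λ x → ∀ i → Automaton.initial (G i) (x i)
  ; secret = λ x → ∀ i → Automaton.secret (G i) (x i) }
  where
  St : Set
  St = (i : Fin k) → Automaton.State (G i)
  ctrans : St → Evt E → St → Set
  ctrans x τ y = ∃ λ i → Automaton.trans (G i) (x i) τ (y i) ×
                         (∀ j → ¬ j ≡ i → y j ≡ x j)
  ctrans x (ev σ) y =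
    (∃ λ i → σ ∈ Automaton.alphabet (G i)) ×
    (∀ j → (σ ∈ Automaton.alphabet (G j) × Automaton.trans (G j) (x j) (ev σ) (y j))
         ⊎ (¬ σ ∈ Automaton.alphabet (G j) × y j ≡ x j))

replaceFirst : ∀ {E} {n : ℕ} → (Fin (sucℕ n) → Automaton E) → Automaton E → (Fin (sucℕ n) → Automaton E)
replaceFirst G H zero = H
replaceFirst G H (suc i) = G (suc i)

-- The proof is a simulation argument.  An *opacity simulation* of one system
-- by another is a relation matching every step by a weak path with the same
-- observation, every initial state by an initial state, and respecting
-- secrecy.  Opacity simulations in both directions transfer current-state
-- opacity (opacity-transfer).  Opacity simulations are a congruence for
-- synchronous composition: an opacity simulation of the first components,
-- together with a step-by-step simulation of the remaining components, lifts
-- to an opacity simulation of the compositions (compose-simulation).  Finally,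
-- an opaque observation equivalence ∼ is an opacity simulation between an
-- automaton and its quotient, in both directions (quotient-simulation,
-- quotient-simulated), while the untouched components are related by
-- equality.  The theorem is the two resulting transfers.
module Submission where

open import Defs
open import Data.Nat using (ℕ; suc)
open import Data.Fin using (Fin; zero)
open import Function.Bundles using (_⇔_)
import Data.Fin as F
open import Data.List using (List; []; _∷_; _++_)
open import Data.List.Membership.Propositional using (_∈_)
open import Data.Product using (∃; _×_; _,_)
open import Data.Sum using (_⊎_; inj₁; inj₂)
open import Data.Empty using (⊥-elim)
open import Relation.Nullary using (¬_)
open import Relation.Binary.PropositionalEquality
  using (_≡_; refl; sym; cong; subst)
  renaming (trans to ≡-trans)
open import Relation.Binary.Structures using (IsEquivalence)
open import Data.Fin.Properties using (suc-injective)
open import Function using (_∘_)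
open import Function.Bundles using (mk⇔; module Equivalence)

module _ {E : Set} where

  _⊩_⇒[_]_ : (L : LTS E) → LTS.State L → List E → LTS.State L → Set
  L ⊩ p ⇒[ s ] q = _⇒[_]_ L p s q

  obs : Evt E → List E
  obs τ = []
  obs (ev σ) = σ ∷ []

  module _ {L : LTS E} where
    open LTS L

    ⇒-++ : ∀ {p q r s t} → L ⊩ p ⇒[ s ] q → L ⊩ q ⇒[ t ] r → L ⊩ p ⇒[ s ++ t ] r
    ⇒-++ done q = q
    ⇒-++ (stepτ t p) q = stepτ t (⇒-++ p q)
    ⇒-++ (stepσ t p) q = stepσ t (⇒-++ p q)

    ⇒-step : ∀ {p e q} → trans p e q → L ⊩ p ⇒[ obs e ] q
    ⇒-step {e = τ} t = stepτ t done
    ⇒-step {e = ev σ} t = stepσ t done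

    ⇒-σ-split : ∀ {p q σ s} → L ⊩ p ⇒[ σ ∷ s ] q →
                ∃ λ a → ∃ λ a' → L ⊩ p ⇒[ [] ] a × trans a (ev σ) a' × L ⊩ a' ⇒[ s ] q
    ⇒-σ-split (stepτ t p) =
      let (a , a' , p₁ , t' , p₂) = ⇒-σ-split p in a , a' , stepτ t p₁ , t' , p₂
    ⇒-σ-split (stepσ t p) = _ , _ , done , t , p

  WeakSimulation : (L₁ L₂ : LTS E) → (LTS.State L₁ → LTS.State L₂ → Set) → Set
  WeakSimulation L₁ L₂ R =
    ∀ {x y e x'} → R x y → LTS.trans L₁ x e x' → ∃ λ y' → L₂ ⊩ y ⇒[ obs e ] y' × R x' y'

  simulate-path : ∀ {L₁ L₂ : LTS E} {R : LTS.State L₁ → LTS.State L₂ → Set} →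
                  WeakSimulation L₁ L₂ R →
                  ∀ {x y s x'} → R x y → L₁ ⊩ x ⇒[ s ] x' → ∃ λ y' → L₂ ⊩ y ⇒[ s ] y' × R x' y'
  simulate-path sim r done = _ , done , r
  simulate-path sim r (stepτ t p) =
    let (y₁ , q₁ , r₁) = sim r t
        (y' , q' , r') = simulate-path sim r₁ p
    in y' , ⇒-++ q₁ q' , r'
  simulate-path sim r (stepσ t p) =
    let (y₁ , q₁ , r₁) = sim r t
        (y' , q' , r') = simulate-path sim r₁ p
    in y' , ⇒-++ q₁ q' , r'

  record OpacitySimulation (L₁ L₂ : LTS E) : Set₁ where
    field
      _≈_         : LTS.State L₁ → LTS.State L₂ → Set
      simulation  : WeakSimulation L₁ L₂ _≈_
      initial-sim : ∀ {x} → LTS.initial L₁ x → ∃ λ y → LTS.initial L₂ y × x ≈ y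
      secret-resp : ∀ {x y} → x ≈ y → LTS.secret L₁ x ⇔ LTS.secret L₂ y

  -- Opacity simulations in both directions transfer current-state opacity:
  -- a secret-revealing run of L₂ is pulled back to L₁, where opacity supplies
  -- a non-secret run with the same observation, which is pushed back to L₂.
  opacity-transfer : ∀ {L₁ L₂ : LTS E} → OpacitySimulation L₁ L₂ → OpacitySimulation L₂ L₁ →
                     CurrentStateOpaque L₁ → CurrentStateOpaque L₂
  opacity-transfer S T opaque₁ y₀ s iy₀ (y , y₀⇒y , secret-y) =
    let (x₀ , ix₀ , y₀≈x₀) = T.initial-sim iy₀
        (x , x₀⇒x , y≈x) = simulate-path T.simulation y₀≈x₀ y₀⇒y
        secret-x = Equivalence.to (T.secret-resp y≈x) secret-y
        (x₀' , ix₀' , x' , x₀'⇒x' , ¬secret-x') = opaque₁ x₀ s ix₀ (x , x₀⇒x , secret-x)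
        (y₀' , iy₀' , x₀'≈y₀') = S.initial-sim ix₀'
        (y' , y₀'⇒y' , x'≈y') = simulate-path S.simulation x₀'≈y₀' x₀'⇒x'
    in y₀' , iy₀' , y' , y₀'⇒y' , ¬secret-x' ∘ Equivalence.from (S.secret-resp x'≈y')
    where
    module S = OpacitySimulation S
    module T = OpacitySimulation T

  Move : (A : Automaton E) → E → Automaton.State A → Automaton.State A → Set
  Move A σ a b = (σ ∈ Automaton.alphabet A × Automaton.trans A a (ev σ) b)
               ⊎ (¬ σ ∈ Automaton.alphabet A × b ≡ a)

module Composition {E : Set} {n : ℕ} (F : Fin (suc n) → Automaton E) where
  open LTS (compose F) using (State; trans)

  Head : Set
  Head = Automaton.State (F zero)

  Tail : Set
  Tail = (i : Fin n) → Automaton.State (F (F.suc i))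

  head : State → Head
  head x = x zero

  tail : State → Tail
  tail x i = x (F.suc i)

  _◂_ : Head → Tail → State
  (a ◂ t) zero = a
  (a ◂ t) (F.suc i) = t i

  Active : E → Set
  Active σ = ∃ λ i → σ ∈ Automaton.alphabet (F i)

  TailTau : Tail → Tail → Set
  TailTau t t' = ∃ λ i → Automaton.trans (F (F.suc i)) (t i) τ (t' i) ×
                         (∀ j → ¬ j ≡ i → t' j ≡ t j)

  TailSync : E → Tail → Tail → Set
  TailSync σ t t' = ∀ j → Move (F (F.suc j)) σ (t j) (t' j)

  TailInitial : Tail → Set
  TailInitial t = ∀ i → Automaton.initial (F (F.suc i)) (t i)

  TailSecret : Tail → Set
  TailSecret t = ∀ i → Automaton.secret (F (F.suc i)) (t i)

  τ-step-cases : ∀ {x x'} → trans x τ x' →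
                 (Automaton.trans (F zero) (head x) τ (head x') × (∀ i → tail x' i ≡ tail x i))
                 ⊎ (head x' ≡ head x × TailTau (tail x) (tail x'))
  τ-step-cases (zero , t , rest) = inj₁ (t , λ i → rest (F.suc i) λ ())
  τ-step-cases (F.suc i , t , rest) =
    inj₂ (rest zero (λ ()) , i , t , λ j j≢i → rest (F.suc j) (j≢i ∘ suc-injective))

  head-τ-step : ∀ {x b} → Automaton.trans (F zero) (head x) τ b → trans x τ (b ◂ tail x)
  head-τ-step t = zero , t , λ { zero ne → ⊥-elim (ne refl) ; (F.suc j) _ → refl }

  tail-τ-step : ∀ {x t'} → TailTau (tail x) t' → trans x τ (head x ◂ t')
  tail-τ-step (i , t , rest) =
    F.suc i , t , λ { zero _ → refl ; (F.suc j) ne → rest j (ne ∘ cong F.suc) }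

  sync-step : ∀ {x σ b t'} → Active σ → Move (F zero) σ (head x) b → TailSync σ (tail x) t' →
              trans x (ev σ) (b ◂ t')
  sync-step act m ms = act , λ { zero → m ; (F.suc j) → ms j }

  lift-head-τ* : ∀ {x b} → F zero ⊢ head x ⇒[ [] ] b →
                 ∃ λ x' → compose F ⊩ x ⇒[ [] ] x' × head x' ≡ b × tail x' ≡ tail x
  lift-head-τ* done = _ , done , refl , refl
  lift-head-τ* {x} (stepτ {p' = a} t p) =
    let (x' , q , h , tl) = lift-head-τ* {a ◂ tail x} p
    in x' , stepτ (head-τ-step t) q , h , tl

  lift-head-σ : ∀ {x σ b t'} → F zero ⊢ head x ⇒[ σ ∷ [] ] b → TailSync σ (tail x) t' →
                ∃ λ x' → compose F ⊩ x ⇒[ σ ∷ [] ] x' × head x' ≡ b × tail x' ≡ t'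
  lift-head-σ {σ = σ} {t' = t'} p ms =
    let (a , a' , p₁ , t , p₂) = ⇒-σ-split p
        (x₁ , q₁ , h₁ , tl₁) = lift-head-τ* p₁
        (x₂ , q₂ , h₂ , tl₂) = lift-head-τ* {a' ◂ t'} p₂
        head-move = inj₁ (Automaton.trans-ok (F zero) t ,
                          subst (λ z → Automaton.trans (F zero) z (ev σ) a') (sym h₁) t)
        tail-move = subst (λ u → TailSync σ u t') (sym tl₁) ms
        sync = sync-step (zero , Automaton.trans-ok (F zero) t) head-move tail-move
    in x₂ , ⇒-++ q₁ (stepσ sync q₂) , h₂ , tl₂

  TailTau-resp : ∀ {t u t'} → (∀ i → t i ≡ u i) → TailTau t t' → TailTau u t'
  TailTau-resp {t' = t'} t≗u (i , st , rest) =
    i , subst (λ z → Automaton.trans (F (F.suc i)) z τ (t' i)) (t≗u i) st ,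
    λ j ne → ≡-trans (rest j ne) (t≗u j)

  TailSync-resp : ∀ {σ t u t'} → (∀ i → t i ≡ u i) → TailSync σ t t' → TailSync σ u t'
  TailSync-resp {σ} {t' = t'} t≗u ms j with ms j
  ... | inj₁ (m , st) = inj₁ (m , subst (λ z → Automaton.trans (F (F.suc j)) z (ev σ) (t' j)) (t≗u j) st)
  ... | inj₂ (m , stay) = inj₂ (m , ≡-trans stay (t≗u j))

  TailSecret-resp : ∀ {t u} → (∀ i → t i ≡ u i) → TailSecret t ⇔ TailSecret u
  TailSecret-resp t≗u =
    mk⇔ (λ s i → subst (Automaton.secret (F (F.suc i))) (t≗u i) (s i))
        (λ s i → subst (Automaton.secret (F (F.suc i))) (sym (t≗u i)) (s i))

module _ {E : Set} {n : ℕ} where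
  open Composition

  record TailSimulation (F₁ F₂ : Fin (suc n) → Automaton E) : Set₁ where
    field
      _≈_         : Tail F₁ → Tail F₂ → Set
      ≈-respˡ     : ∀ {t t' u} → (∀ i → t' i ≡ t i) → t ≈ u → t' ≈ u
      τ-sim       : ∀ {t u t'} → t ≈ u → TailTau F₁ t t' → ∃ λ u' → TailTau F₂ u u' × t' ≈ u'
      sync-sim    : ∀ {σ t u t'} → t ≈ u → TailSync F₁ σ t t' →
                    ∃ λ u' → TailSync F₂ σ u u' × t' ≈ u'
      initial-sim : ∀ {t} → TailInitial F₁ t → ∃ λ u → TailInitial F₂ u × t ≈ u
      secret-resp : ∀ {t u} → t ≈ u → TailSecret F₁ t ⇔ TailSecret F₂ u

  identical-tails : (F : Fin (suc n) → Automaton E) → TailSimulation F F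
  identical-tails F = record
    { _≈_ = λ t u → ∀ i → t i ≡ u i
    ; ≈-respˡ = λ t'≗t t≗u i → ≡-trans (t'≗t i) (t≗u i)
    ; τ-sim = λ t≗u st → _ , TailTau-resp F t≗u st , λ _ → refl
    ; sync-sim = λ t≗u ms → _ , TailSync-resp F t≗u ms , λ _ → refl
    ; initial-sim = λ it → _ , it , λ _ → refl
    ; secret-resp = TailSecret-resp F }

  compose-simulation : ∀ (F₁ F₂ : Fin (suc n) → Automaton E) →
                       (∀ i → Automaton.alphabet (F₁ i) ≡ Automaton.alphabet (F₂ i)) →
                       OpacitySimulation (toLTS (F₁ zero)) (toLTS (F₂ zero)) →
                       TailSimulation F₁ F₂ →
                       OpacitySimulation (compose F₁) (compose F₂)
  compose-simulation F₁ F₂ same-alphabets H T = record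
    { _≈_ = _≈_
    ; simulation = λ { {e = τ} → simulate-τ ; {e = ev σ} → simulate-σ }
    ; initial-sim = initial-sim
    ; secret-resp = secret-resp }
    where
    module H = OpacitySimulation H
    module T = TailSimulation T
    module C₁ = Composition F₁
    module C₂ = Composition F₂
    open LTS (compose F₁) using () renaming (trans to trans₁)

    _≈_ : LTS.State (compose F₁) → LTS.State (compose F₂) → Set
    x ≈ y = C₁.head x H.≈ C₂.head y × C₁.tail x T.≈ C₂.tail y

    simulate-τ : ∀ {x y x'} → x ≈ y → trans₁ x τ x' → ∃ λ y' → compose F₂ ⊩ y ⇒[ [] ] y' × x' ≈ y'
    simulate-τ {x' = x'} (h≈ , t≈) step with C₁.τ-step-cases step
    ... | inj₁ (st , tail-stays) =
      let (b , p , hb) = H.simulation h≈ st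
          (y' , q , h' , tl') = C₂.lift-head-τ* p
      in y' , q , subst (C₁.head x' H.≈_) (sym h') hb ,
         subst (C₁.tail x' T.≈_) (sym tl') (T.≈-respˡ tail-stays t≈)
    ... | inj₂ (head-stays , st) =
      let (u' , st' , tu') = T.τ-sim t≈ st
      in _ , stepτ (C₂.tail-τ-step st') done , subst (H._≈ _) (sym head-stays) h≈ , tu'

    simulate-σ : ∀ {x y σ x'} → x ≈ y → trans₁ x (ev σ) x' →
                 ∃ λ y' → compose F₂ ⊩ y ⇒[ σ ∷ [] ] y' × x' ≈ y'
    simulate-σ {σ = σ} {x'} (h≈ , t≈) (act , moves) with T.sync-sim t≈ (moves ∘ F.suc) | moves zero
    ... | u' , ms' , tu' | inj₁ (_ , st) =
      let (b , p , hb) = H.simulation h≈ st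
          (y' , q , h' , tl') = C₂.lift-head-σ p ms'
      in y' , q , subst (C₁.head x' H.≈_) (sym h') hb , subst (C₁.tail x' T.≈_) (sym tl') tu'
    ... | u' , ms' , tu' | inj₂ (σ∉ , head-stays) =
      let (i , σ∈) = act
          act' = i , subst (σ ∈_) (same-alphabets i) σ∈
          head-move = inj₂ (σ∉ ∘ subst (σ ∈_) (sym (same-alphabets zero)) , refl)
      in _ , stepσ (C₂.sync-step act' head-move ms') done ,
         subst (H._≈ _) (sym head-stays) h≈ , tu'

    initial-sim : ∀ {x} → LTS.initial (compose F₁) x →
                  ∃ λ y → LTS.initial (compose F₂) y × x ≈ y
    initial-sim ix =
      let (b , ib , hb) = H.initial-sim (ix zero)
          (u , iu , tu) = T.initial-sim (ix ∘ F.suc)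
      in (b C₂.◂ u) , (λ { zero → ib ; (F.suc i) → iu i }) , hb , tu

    secret-resp : ∀ {x y} → x ≈ y → LTS.secret (compose F₁) x ⇔ LTS.secret (compose F₂) y
    secret-resp (h≈ , t≈) =
      mk⇔ (λ s → λ { zero → Equivalence.to (H.secret-resp h≈) (s zero)
                    ; (F.suc i) → Equivalence.to (T.secret-resp t≈) (s ∘ F.suc) i })
          (λ s → λ { zero → Equivalence.from (H.secret-resp h≈) (s zero)
                    ; (F.suc i) → Equivalence.from (T.secret-resp t≈) (s ∘ F.suc) i })

module _ {E : Set} (A : Automaton E) (_∼_ : Automaton.State A → Automaton.State A → Set)
         (O : IsOpaqueObsEquiv A _∼_) where
  open IsOpaqueObsEquiv O
  open IsEquivalence isEquivalence renaming (refl to ∼-refl; sym to ∼-sym; trans to ∼-trans)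

  -- A step x → x' is matched from any y ∼ x by the quotient step [y] → [x'].
  quotient-simulation : OpacitySimulation (toLTS A) (toLTS (quotient A _∼_))
  quotient-simulation = record
    { _≈_ = _∼_
    ; simulation = λ {x} x∼y t → _ , ⇒-step (x , _ , ∼-sym x∼y , ∼-refl , t) , ∼-refl
    ; initial-sim = λ {x} ix → x , (x , ix , ∼-refl) , ∼-refl
    ; secret-resp = secret-resp }

  -- A quotient step [a] → [b] comes from a concrete step a' → b'; the
  -- observation equivalence lets any x ∼ a' follow it by a weak path.
  quotient-simulated : OpacitySimulation (toLTS (quotient A _∼_)) (toLTS A)
  quotient-simulated = record
    { _≈_ = _∼_
    ; simulation = follow
    ; initial-sim = λ { (x₀ , ix₀ , x∼x₀) → x₀ , ix₀ , x∼x₀ }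
    ; secret-resp = secret-resp }
    where
    follow : WeakSimulation (toLTS (quotient A _∼_)) (toLTS A) _∼_
    follow a∼x (a' , b' , a∼a' , b∼b' , t) =
      let (c , p , b'∼c) = simulation (∼-trans (∼-sym a∼a') a∼x) (⇒-step t)
      in c , p , ∼-trans b∼b' b'∼c

corollary1 : ∀ {E : Set} (n : ℕ) (G : Fin (suc n) → Automaton E)
    (_∼_ : Automaton.State (G zero) → Automaton.State (G zero) → Set) →
    IsOpaqueObsEquiv (G zero) _∼_ →
    CurrentStateOpaque (compose G) ⇔
    CurrentStateOpaque (compose (replaceFirst G (quotient (G zero) _∼_)))
corollary1 n G _∼_ O =
  mk⇔ (opacity-transfer forward backward) (opacity-transfer backward forward)
  where
  G̃ = replaceFirst G (quotient (G zero) _∼_)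

  same-alphabets : ∀ i → Automaton.alphabet (G i) ≡ Automaton.alphabet (G̃ i)
  same-alphabets zero = refl
  same-alphabets (F.suc i) = refl

  module Kept = TailSimulation (identical-tails G)

  forward : OpacitySimulation (compose G) (compose G̃)
  forward = compose-simulation G G̃ same-alphabets
              (quotient-simulation (G zero) _∼_ O) record { Kept }

  backward : OpacitySimulation (compose G̃) (compose G)
  backward = compose-simulation G̃ G (sym ∘ same-alphabets)
               (quotient-simulated (G zero) _∼_ O) record { Kept }
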